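{- Let $M$ be a matroid with at least two elements. Then $M$ is $U_{1,2} \oplus U_{1,1}$-connected if and only if $M$ is loopless, has at most one coloop, and has at most one free element.
   Context: A matroid $M$ with $|E(M)| \geq 2$ is $N$-connected if for every pair of distinct elements $e,f \in E(M)$ there is a minor of $M$ isomorphic to $N$ whose ground set contains $\{e,f\}$. An element of $M$ is free if it is not a coloop and every circuit of $M$ containing it is spanning. -}

module Defs where

open import Data.Nat using (ℕ; _<_; _≥_)
open import Data.Fin using (Fin; zero; suc; _≟_)
open import Data.Fin.Subset using (Subset; _∈_; _∉_; _⊆_; _∪_; ⁅_⁆; ∣_∣; ⊥; _-_)
open import Data.Fin.Subset.Properties using (_∈?_)
open import Data.Fin.Properties using (any?)
open import Data.Vec using (tabulate)
open import Data.Product using (Σ; ∃; _×_; _,_)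
open import Relation.Nullary using (¬_; Dec; does)
open import Relation.Nullary.Decidable using (_×-dec_)
open import Relation.Binary.PropositionalEquality using (_≡_; _≢_)
open import Function.Definitions using (Injective)

record Matroid (n : ℕ) : Set₁ where
  field
    Indep      : Subset n → Set
    indep?     : (I : Subset n) → Dec (Indep I)
    indep-⊥    : Indep ⊥
    indep-⊆    : ∀ {I J} → J ⊆ I → Indep I → Indep J
    augment    : ∀ {I J} → Indep I → Indep J → ∣ I ∣ < ∣ J ∣ →
                 Σ (Fin n) λ x → x ∈ J × x ∉ I × Indep (I ∪ ⁅ x ⁆)

module _ {n : ℕ} (M : Matroid n) where
  open Matroid M

  IsBasisOf : Subset n → Subset n → Set
  IsBasisOf B X = B ⊆ X × Indep B × (∀ x → x ∈ X → Indep (B ∪ ⁅ x ⁆) → x ∈ B)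

  IsBasis : Subset n → Set
  IsBasis B = Indep B × (∀ x → Indep (B ∪ ⁅ x ⁆) → x ∈ B)

  IsCircuit : Subset n → Set
  IsCircuit C = ¬ Indep C × (∀ x → x ∈ C → Indep (C - x))

  Spanning : Subset n → Set
  Spanning X = Σ (Subset n) λ B → B ⊆ X × IsBasis B

  IsLoop : Fin n → Set
  IsLoop e = ¬ Indep ⁅ e ⁆

  Loopless : Set
  Loopless = ∀ e → ¬ IsLoop e

  IsColoop : Fin n → Set
  IsColoop e = ∀ B → IsBasis B → e ∈ B

  IsFree : Fin n → Set
  IsFree e = ¬ IsColoop e × (∀ C → IsCircuit C → e ∈ C → Spanning C)

  AtMostOne : (Fin n → Set) → Set
  AtMostOne P = ∀ e f → P e → P f → e ≡ f

  -- independence in the contraction M / C (for J disjoint from C):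
  -- J ∪ B is independent for a basis B of M|C
  IndepContract : Subset n → Subset n → Set
  IndepContract C J = Σ (Subset n) λ B → IsBasisOf B C × Indep (J ∪ B)

image : ∀ {k n} → (Fin k → Fin n) → Subset k → Subset n
image φ I = tabulate λ y → does (any? λ x → (x ∈? I) ×-dec (φ x ≟ y))

-- M has a minor (M / C) \ D isomorphic to the matroid on Fin k with independence
-- predicate IndepN, whose ground set contains e and f.  The ground set of the minor is
-- the image of the injection φ (disjoint from C); D is the complement of C ∪ image φ.
HasMinorWith : ∀ {n k} → Matroid n → (Subset k → Set) → Fin n → Fin n → Set
HasMinorWith {n} {k} M IndepN e f =
  Σ (Subset n) λ C → Σ (Fin k → Fin n) λ φ →
    Injective _≡_ _≡_ φ × (∀ x → φ x ∉ C) ×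
    (∃ λ a → φ a ≡ e) × (∃ λ b → φ b ≡ f) ×
    (∀ I → (IndepN I → IndepContract M C (image φ I)) × (IndepContract M C (image φ I) → IndepN I))

Connected-for : ∀ {n k} → (Subset k → Set) → Matroid n → Set
Connected-for {n} IndepN M = n ≥ 2 × (∀ e f → e ≢ f → HasMinorWith M IndepN e f)

-- U_{1,2} ⊕ U_{1,1} on ground set Fin 3 = {0,1,2}: U_{1,2} on {0,1}, U_{1,1} on {2}.
-- A set is independent iff it does not contain both 0 and 1.
U12⊕U11-Indep : Subset 3 → Set
U12⊕U11-Indep I = ¬ (zero ∈ I × suc zero ∈ I)

-- Necessity.  Let M / C restricted to {x, y, z} be a U_{1,2} ⊕ U_{1,1}-minor, x and y parallel,
-- and B a basis of C.  No element of the minor is a loop, and of two distinct ones at least one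
-- lies in {x, y}, so it suffices that x is neither a coloop nor free.  A coloop x lies in a basis
-- extending B + y, making B + x + y independent.  If x were free, the circuit through x inside
-- B + y + x would span M, so M would have rank at most |B| + 1, while B + x + z is independent.
--
-- Sufficiency.  A coloop lies in no circuit and a free element lies in a spanning circuit, so
-- the two never coexist; hence of two distinct elements e, f one, say e, lies in a non-spanning
-- circuit D.  Contracting all of D but two elements u, v leaves u, v parallel, and an element of a
-- basis outside D supplies the coloop.  Basis exchange moves f into such a triple: directly if
-- f ∈ D, via D - e + f if it is independent, and otherwise via the circuit of D - e + f.

module Submission where

open import Defs
open import Data.Bool using (true)
open import Data.Empty using (⊥; ⊥-elim)
open import Data.Fin using (Fin; zero; suc; _≟_)
open import Data.Fin.Properties using (any?; all?)
open import Data.Fin.Subset hiding (⊥)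
open import Data.Fin.Subset.Properties
open import Data.List using (List; allFin) renaming ([] to []ˡ; _∷_ to _∷ˡ_)
open import Data.List.Membership.Propositional using () renaming (_∈_ to _∈ˡ_)
open import Data.List.Membership.Propositional.Properties using (∈-allFin)
open import Data.List.Relation.Unary.Any using () renaming (here to hereˡ; there to thereˡ)
open import Data.Nat using (ℕ; _≥_; _<_; _≤_; _+_; suc; s≤s)
open import Data.Nat.Properties
  using (≤-refl; ≤-reflexive; ≤-trans; ≤-<-trans; <-irrefl; ≮⇒≥; n≤1+n; +-monoʳ-≤; +-suc; +-comm;
         module ≤-Reasoning)
open import Data.Product using (Σ; ∃; _×_; _,_; proj₁; proj₂)
open import Data.Sum using (_⊎_; inj₁; inj₂; [_,_]′)
open import Data.Vec using ([]; _∷_; here; there)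
open import Data.Vec.Properties using (lookup∘tabulate; []=⇒lookup; lookup⇒[]=)
open import Function using (_∘_)
open import Function.Bundles using (_⇔_; mk⇔)
open import Function.Definitions using (Injective)
open import Relation.Binary.PropositionalEquality using (_≡_; _≢_; refl; sym; trans; cong)
open import Relation.Nullary using (¬_; Dec; yes; no; does)
open import Relation.Nullary.Decidable using (decidable-stable; _×-dec_; _→-dec_; ¬?)

infixl 5 _+ₛ_

_+ₛ_ : ∀ {n} → Subset n → Fin n → Subset n
S +ₛ x = S ∪ ⁅ x ⁆

x∈p─q⇒x∉q : ∀ {n} {p q : Subset n} {x} → x ∈ p ─ q → x ∉ q
x∈p─q⇒x∉q {p = _ ∷ _} {inside ∷ _} () here
x∈p─q⇒x∉q {p = _ ∷ _} {_ ∷ _} (there x∈) (there x∈q) = x∈p─q⇒x∉q x∈ x∈q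

∣p∪q∣≤∣p∣+∣q∣ : ∀ {n} (p q : Subset n) → ∣ p ∪ q ∣ ≤ ∣ p ∣ + ∣ q ∣
∣p∪q∣≤∣p∣+∣q∣ [] [] = ≤-refl
∣p∪q∣≤∣p∣+∣q∣ (outside ∷ p) (outside ∷ q) = ∣p∪q∣≤∣p∣+∣q∣ p q
∣p∪q∣≤∣p∣+∣q∣ (outside ∷ p) (inside ∷ q) =
  ≤-trans (s≤s (∣p∪q∣≤∣p∣+∣q∣ p q)) (≤-reflexive (sym (+-suc ∣ p ∣ ∣ q ∣)))
∣p∪q∣≤∣p∣+∣q∣ (inside ∷ p) (outside ∷ q) = s≤s (∣p∪q∣≤∣p∣+∣q∣ p q)
∣p∪q∣≤∣p∣+∣q∣ (inside ∷ p) (inside ∷ q) =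
  s≤s (≤-trans (∣p∪q∣≤∣p∣+∣q∣ p q) (+-monoʳ-≤ ∣ p ∣ (n≤1+n ∣ q ∣)))

module _ {n : ℕ} where

  private variable
    S T : Subset n
    w x y : Fin n

  ∈-+ˡ : w ∈ S → w ∈ S +ₛ x
  ∈-+ˡ w∈S = x∈p∪q⁺ (inj₁ w∈S)

  ∈-+ʳ : x ∈ S +ₛ x
  ∈-+ʳ {x = x} = x∈p∪q⁺ (inj₂ (x∈⁅x⁆ x))

  ∈-+⁻ : w ∈ S +ₛ x → w ∈ S ⊎ w ≡ x
  ∈-+⁻ {S = S} {x = x} w∈ with x∈p∪q⁻ S ⁅ x ⁆ w∈
  ... | inj₁ w∈S = inj₁ w∈S
  ... | inj₂ w∈x = inj₂ (x∈⁅y⁆⇒x≡y x w∈x)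

  +-lub : S ⊆ T → x ∈ T → S +ₛ x ⊆ T
  +-lub S⊆T x∈T w∈ with ∈-+⁻ w∈
  ... | inj₁ w∈S = S⊆T w∈S
  ... | inj₂ refl = x∈T

  +-mono : S ⊆ T → S +ₛ x ⊆ T +ₛ x
  +-mono S⊆T = +-lub (∈-+ˡ ∘ S⊆T) ∈-+ʳ

  +-swap : S +ₛ x +ₛ y ⊆ S +ₛ y +ₛ x
  +-swap = +-lub (+-mono ∈-+ˡ) (∈-+ˡ ∈-+ʳ)

  ∪-lub : ∀ {S S′} → S ⊆ T → S′ ⊆ T → S ∪ S′ ⊆ T
  ∪-lub {S = S} {S′} S⊆T S′⊆T w∈ with x∈p∪q⁻ S S′ w∈
  ... | inj₁ w∈S = S⊆T w∈S
  ... | inj₂ w∈S′ = S′⊆T w∈S′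

  x∈p-y⇒x∈p : w ∈ S - x → w ∈ S
  x∈p-y⇒x∈p {S = S} {x = x} = p─q⊆p S ⁅ x ⁆

  x∈p-y⇒x≢y : w ∈ S - x → w ≢ x
  x∈p-y⇒x≢y w∈ refl = x∈p─q⇒x∉q w∈ (x∈⁅x⁆ _)

  p⊆q⇒p-x⊆q-x : S ⊆ T → S - x ⊆ T - x
  p⊆q⇒p-x⊆q-x S⊆T w∈ = x∈p∧x≢y⇒x∈p-y (S⊆T (x∈p-y⇒x∈p w∈)) (x∈p-y⇒x≢y w∈)

  p⊆q+x∧x∉p⇒p⊆q : S ⊆ T +ₛ x → x ∉ S → S ⊆ T
  p⊆q+x∧x∉p⇒p⊆q S⊆Tx x∉S w∈ with ∈-+⁻ (S⊆Tx w∈)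
  ... | inj₁ w∈T = w∈T
  ... | inj₂ refl = ⊥-elim (x∉S w∈)

  p⊆q+x⇒p-x⊆q : S ⊆ T +ₛ x → S - x ⊆ T
  p⊆q+x⇒p-x⊆q S⊆Tx w∈ with ∈-+⁻ (S⊆Tx (x∈p-y⇒x∈p w∈))
  ... | inj₁ w∈T = w∈T
  ... | inj₂ refl = ⊥-elim (x∈p-y⇒x≢y w∈ refl)

  ⊆-or-∉ : ∀ (S T : Subset n) → S ⊆ T ⊎ ∃ λ x → x ∈ S × x ∉ T
  ⊆-or-∉ S T with any? (λ x → (x ∈? S) ×-dec ¬? (x ∈? T))
  ... | yes outside-T = inj₂ outside-T
  ... | no none = inj₁ λ {x} x∈S → decidable-stable (x ∈? T) λ x∉T → none (x , x∈S , x∉T)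

  p-x-y+y⊆p-x : y ∈ S → y ≢ x → S - x - y +ₛ y ⊆ S - x
  p-x-y+y⊆p-x y∈S y≢x = +-lub x∈p-y⇒x∈p (x∈p∧x≢y⇒x∈p-y y∈S y≢x)

  p⊆p-x+x : S ⊆ S - x +ₛ x
  p⊆p-x+x {S} {x} {w} w∈ with w ≟ x
  ... | yes refl = ∈-+ʳ
  ... | no w≢x = ∈-+ˡ (x∈p∧x≢y⇒x∈p-y w∈ w≢x)

  ∣p+x∣≤1+∣p∣ : ∀ (S : Subset n) x → ∣ S +ₛ x ∣ ≤ suc ∣ S ∣
  ∣p+x∣≤1+∣p∣ S x = begin
    ∣ S ∪ ⁅ x ⁆ ∣      ≤⟨ ∣p∪q∣≤∣p∣+∣q∣ S ⁅ x ⁆ ⟩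
    ∣ S ∣ + ∣ ⁅ x ⁆ ∣  ≡⟨ cong (∣ S ∣ +_) (∣⁅x⁆∣≡1 x) ⟩
    ∣ S ∣ + 1          ≡⟨ +-comm ∣ S ∣ 1 ⟩
    suc ∣ S ∣          ∎
    where open ≤-Reasoning

  x∉p⇒∣p∣<∣p+x∣ : x ∉ S → ∣ S ∣ < ∣ S +ₛ x ∣
  x∉p⇒∣p∣<∣p+x∣ x∉S = p⊂q⇒∣p∣<∣q∣ (∈-+ˡ , _ , ∈-+ʳ , x∉S)

  ∣p+x+y∣≤2+∣p∣ : ∀ (S : Subset n) x y → ∣ S +ₛ x +ₛ y ∣ ≤ 2 + ∣ S ∣
  ∣p+x+y∣≤2+∣p∣ S x y = ≤-trans (∣p+x∣≤1+∣p∣ (S +ₛ x) y) (s≤s (∣p+x∣≤1+∣p∣ S x))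

  2+∣p∣≤∣p+x+y∣ : x ∉ S → y ∉ S +ₛ x → 2 + ∣ S ∣ ≤ ∣ S +ₛ x +ₛ y ∣
  2+∣p∣≤∣p+x+y∣ x∉S y∉S+x = ≤-trans (s≤s (x∉p⇒∣p∣<∣p+x∣ x∉S)) (x∉p⇒∣p∣<∣p+x∣ y∉S+x)

module _ {k n : ℕ} (φ : Fin k → Fin n) where

  private variable
    I : Subset k
    T : Subset n

  ∈-image⁺ : ∀ {a} → a ∈ I → φ a ∈ image φ I
  ∈-image⁺ {I} {a} a∈I =
    lookup⇒[]= (φ a) _
      (trans (lookup∘tabulate _ (φ a)) (found (any? (λ z → (z ∈? I) ×-dec (φ z ≟ φ a)))))
    where
    found : (d : Dec (∃ λ z → z ∈ I × φ z ≡ φ a)) → does d ≡ true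
    found (yes _) = refl
    found (no none) = ⊥-elim (none (a , a∈I , refl))

  ∈-image⁻ : ∀ {y} → y ∈ image φ I → ∃ λ a → a ∈ I × φ a ≡ y
  ∈-image⁻ {I} {y} y∈ =
    witness (any? (λ z → (z ∈? I) ×-dec (φ z ≟ y)))
      (trans (sym (lookup∘tabulate _ y)) ([]=⇒lookup y∈))
    where
    witness : (d : Dec (∃ λ z → z ∈ I × φ z ≡ y)) → does d ≡ true → ∃ λ a → a ∈ I × φ a ≡ y
    witness (yes p) _ = p

  image-⊆ : (∀ {a} → a ∈ I → φ a ∈ T) → image φ I ⊆ T
  image-⊆ φI⊆T y∈ with ∈-image⁻ y∈
  ... | a , a∈I , refl = φI⊆T a∈I

module MatroidFacts {n : ℕ} (M : Matroid n) where
  open Matroid M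

  private variable
    B B′ D I J S X : Subset n
    a b e f g : Fin n

  dependent-⊇ : J ⊆ I → ¬ Indep J → ¬ Indep I
  dependent-⊇ J⊆I depJ = depJ ∘ indep-⊆ J⊆I

  greedy : List (Fin n) → Subset n → Subset n
  greedy []ˡ I = I
  greedy (x ∷ˡ xs) I with indep? (I +ₛ x)
  ... | yes _ = greedy xs (I +ₛ x)
  ... | no _ = greedy xs I

  greedy-⊇ : ∀ xs I → I ⊆ greedy xs I
  greedy-⊇ []ˡ I = λ w∈ → w∈
  greedy-⊇ (x ∷ˡ xs) I with indep? (I +ₛ x)
  ... | yes _ = greedy-⊇ xs (I +ₛ x) ∘ ∈-+ˡ
  ... | no _ = greedy-⊇ xs I

  greedy-indep : ∀ xs → Indep I → Indep (greedy xs I)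
  greedy-indep []ˡ indI = indI
  greedy-indep {I} (x ∷ˡ xs) indI with indep? (I +ₛ x)
  ... | yes indIx = greedy-indep xs indIx
  ... | no _ = greedy-indep xs indI

  greedy-maximal : ∀ xs I {x} → x ∈ˡ xs → Indep (greedy xs I +ₛ x) → x ∈ greedy xs I
  greedy-maximal (y ∷ˡ xs) I (hereˡ refl) ind with indep? (I +ₛ y)
  ... | yes _ = greedy-⊇ xs (I +ₛ y) ∈-+ʳ
  ... | no depIy = ⊥-elim (depIy (indep-⊆ (+-mono (greedy-⊇ xs I)) ind))
  greedy-maximal (y ∷ˡ xs) I (thereˡ x∈xs) ind with indep? (I +ₛ y)
  ... | yes _ = greedy-maximal xs (I +ₛ y) x∈xs ind
  ... | no _ = greedy-maximal xs I x∈xs ind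

  extend-to-basis : Indep I → Σ (Subset n) λ B → I ⊆ B × IsBasis M B
  extend-to-basis {I} indI =
    greedy (allFin n) I , greedy-⊇ (allFin n) I ,
    greedy-indep (allFin n) indI , λ x → greedy-maximal (allFin n) I (∈-allFin x)

  prune : List (Fin n) → Subset n → Subset n
  prune []ˡ S = S
  prune (x ∷ˡ xs) S with indep? (S - x)
  ... | yes _ = prune xs S
  ... | no _ = prune xs (S - x)

  prune-⊆ : ∀ xs S → prune xs S ⊆ S
  prune-⊆ []ˡ S = λ w∈ → w∈
  prune-⊆ (x ∷ˡ xs) S with indep? (S - x)
  ... | yes _ = prune-⊆ xs S
  ... | no _ = x∈p-y⇒x∈p ∘ prune-⊆ xs (S - x)

  prune-dependent : ∀ xs → ¬ Indep S → ¬ Indep (prune xs S)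
  prune-dependent []ˡ depS = depS
  prune-dependent {S} (x ∷ˡ xs) depS with indep? (S - x)
  ... | yes _ = prune-dependent xs depS
  ... | no depS-x = prune-dependent xs depS-x

  prune-minimal : ∀ xs S {x} → x ∈ˡ xs → x ∈ prune xs S → Indep (prune xs S - x)
  prune-minimal (y ∷ˡ xs) S (hereˡ refl) x∈ with indep? (S - y)
  ... | yes indS-x = indep-⊆ (p⊆q⇒p-x⊆q-x (prune-⊆ xs S)) indS-x
  ... | no _ = ⊥-elim (x∈p-y⇒x≢y (prune-⊆ xs (S - y) x∈) refl)
  prune-minimal (y ∷ˡ xs) S (thereˡ x∈xs) x∈ with indep? (S - y)
  ... | yes _ = prune-minimal xs S x∈xs x∈
  ... | no _ = prune-minimal xs (S - y) x∈xs x∈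

  circuit-within : ¬ Indep X → Σ (Subset n) λ S → S ⊆ X × IsCircuit M S
  circuit-within {X} depX =
    prune (allFin n) X , prune-⊆ (allFin n) X ,
    prune-dependent (allFin n) depX , λ x → prune-minimal (allFin n) X (∈-allFin x)

  isBasis? : ∀ B → Dec (IsBasis M B)
  isBasis? B = indep? B ×-dec all? (λ x → indep? (B +ₛ x) →-dec (x ∈? B))

  spanning? : ∀ X → Dec (Spanning M X)
  spanning? X = anySubset? (λ B → (B ⊆? X) ×-dec isBasis? B)

  isCircuit? : ∀ C → Dec (IsCircuit M C)
  isCircuit? C = ¬? (indep? C) ×-dec all? (λ x → (x ∈? C) →-dec indep? (C - x))

  basisOf-maximum : IsBasisOf M B X → I ⊆ X → Indep I → ∣ I ∣ ≤ ∣ B ∣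
  basisOf-maximum (_ , indB , maxB) I⊆X indI = ≮⇒≥ λ ∣B∣<∣I∣ →
    let x , x∈I , x∉B , indBx = augment indB indI ∣B∣<∣I∣ in x∉B (maxB x (I⊆X x∈I) indBx)

  basis⇒basisOf-⊤ : IsBasis M B → IsBasisOf M B ⊤
  basis⇒basisOf-⊤ (indB , maxB) = (λ _ → ∈⊤) , indB , λ x _ → maxB x

  basis-maximum : IsBasis M B → Indep I → ∣ I ∣ ≤ ∣ B ∣
  basis-maximum basisB = basisOf-maximum (basis⇒basisOf-⊤ basisB) (λ _ → ∈⊤)

  basisOf-indep-⊇ : IsBasisOf M B X → Indep X → X ⊆ B
  basisOf-indep-⊇ (B⊆X , _ , maxB) indX x∈X = maxB _ x∈X (indep-⊆ (+-lub B⊆X x∈X) indX)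

  basisOf-+-indep : IsBasisOf M B X → IsBasisOf M B′ X → g ∉ X → Indep (B′ +ₛ g) → Indep (B +ₛ g)
  basisOf-+-indep {B} {X} {B′} {g} (B⊆X , indB , maxB) basisB′@(B′⊆X , _ , _) g∉X indB′g
    with augment indB indB′g ∣B∣<∣B′+g∣
    where
    ∣B∣<∣B′+g∣ : ∣ B ∣ < ∣ B′ +ₛ g ∣
    ∣B∣<∣B′+g∣ = ≤-<-trans (basisOf-maximum basisB′ B⊆X indB) (x∉p⇒∣p∣<∣p+x∣ (g∉X ∘ B′⊆X))
  ... | x , x∈B′g , x∉B , indBx with ∈-+⁻ x∈B′g
  ... | inj₁ x∈B′ = ⊥-elim (x∉B (maxB x (B′⊆X x∈B′) indBx))
  ... | inj₂ refl = indBx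

  -- In M / J, with b not a loop: if a, b are parallel and a, g independent, so are b, g.
  exchange : a ≢ g → Indep (J +ₛ b) → Indep (J +ₛ a +ₛ g) → ¬ Indep (J +ₛ a +ₛ b) →
             Indep (J +ₛ b +ₛ g)
  exchange {a} {g} {J} {b} a≢g indJb indJag depJab with g ∈? J
  ... | yes g∈J = indep-⊆ (+-lub (λ w∈ → w∈) (∈-+ˡ g∈J)) indJb
  ... | no g∉J with augment indJb indJag ∣J+b∣<∣J+a+g∣
    where
    a∉J : a ∉ J
    a∉J a∈J = depJab (indep-⊆ (+-lub (+-lub ∈-+ˡ (∈-+ˡ a∈J)) ∈-+ʳ) indJb)
    g∉J+a : g ∉ J +ₛ a
    g∉J+a g∈ = [ g∉J , a≢g ∘ sym ]′ (∈-+⁻ g∈)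
    ∣J+b∣<∣J+a+g∣ : ∣ J +ₛ b ∣ < ∣ J +ₛ a +ₛ g ∣
    ∣J+b∣<∣J+a+g∣ = ≤-trans (s≤s (∣p+x∣≤1+∣p∣ J b)) (2+∣p∣≤∣p+x+y∣ a∉J g∉J+a)
  ... | x , x∈J+a+g , x∉J+b , indJbx with ∈-+⁻ x∈J+a+g
  ... | inj₂ refl = indJbx
  ... | inj₁ x∈J+a with ∈-+⁻ x∈J+a
  ... | inj₁ x∈J = ⊥-elim (x∉J+b (∈-+ˡ x∈J))
  ... | inj₂ refl = ⊥-elim (depJab (indep-⊆ +-swap indJbx))

  fundamental-circuit : Indep I → ¬ Indep (I +ₛ e) →
                        Σ (Subset n) λ S → S ⊆ I +ₛ e × IsCircuit M S × e ∈ S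
  fundamental-circuit {I} {e} indI depIe with circuit-within depIe
  ... | S , S⊆I+e , circS with e ∈? S
  ... | yes e∈S = S , S⊆I+e , circS , e∈S
  ... | no e∉S = ⊥-elim (proj₁ circS (indep-⊆ (p⊆q+x∧x∉p⇒p⊆q S⊆I+e e∉S) indI))

  indep⊆dependent⇒⊂ : I ⊆ S → Indep I → ¬ Indep S → I ⊂ S
  indep⊆dependent⇒⊂ {I} {S} I⊆S indI depS with ⊆-or-∉ S I
  ... | inj₁ S⊆I = ⊥-elim (depS (indep-⊆ S⊆I indI))
  ... | inj₂ (x , x∈S , x∉I) = I⊆S , x , x∈S , x∉I

  spanning-circuit-exceeds-indep : IsCircuit M S → Spanning M S → Indep I → ∣ I ∣ < ∣ S ∣
  spanning-circuit-exceeds-indep (depS , _) (B , B⊆S , basisB) indI =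
    ≤-<-trans (basis-maximum basisB indI) (p⊂q⇒∣p∣<∣q∣ (indep⊆dependent⇒⊂ B⊆S (proj₁ basisB) depS))

  loopless⇒circuit-has-other : Loopless M → IsCircuit M D → ∀ e → ∃ λ w → w ∈ D × w ≢ e
  loopless⇒circuit-has-other {D} loopless (depD , _) e with ⊆-or-∉ D ⁅ e ⁆
  ... | inj₁ D⊆e = ⊥-elim (loopless e (depD ∘ indep-⊆ D⊆e))
  ... | inj₂ (w , w∈D , w∉e) = w , w∈D , x∉⁅y⁆⇒x≢y w∉e

  coloop-or-avoided : ∀ e → IsColoop M e ⊎ Σ (Subset n) λ B → IsBasis M B × e ∉ B
  coloop-or-avoided e with anySubset? (λ B → isBasis? B ×-dec ¬? (e ∈? B))
  ... | yes avoided = inj₂ avoided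
  ... | no none = inj₁ λ B basisB → decidable-stable (e ∈? B) λ e∉B → none (B , basisB , e∉B)

  non-coloop-in-circuit : ¬ IsColoop M e → Σ (Subset n) λ S → IsCircuit M S × e ∈ S
  non-coloop-in-circuit {e} ¬coloop with coloop-or-avoided e
  ... | inj₁ coloop = ⊥-elim (¬coloop coloop)
  ... | inj₂ (B , (indB , maxB) , e∉B) with fundamental-circuit indB (e∉B ∘ maxB e)
  ... | S , _ , circS , e∈S = S , circS , e∈S

  coloop∉circuit : IsColoop M e → IsCircuit M S → e ∉ S
  coloop∉circuit {e} {S} coloop (depS , minS) e∈S with extend-to-basis (minS e e∈S)
  ... | B , S-e⊆B , basisB =
    depS (indep-⊆ (⊆-trans p⊆p-x+x (+-lub S-e⊆B (coloop B basisB))) (proj₁ basisB))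

  coloop-free-exclusive : IsColoop M e → ¬ IsFree M f
  coloop-free-exclusive coloop (¬coloop , spanning) with non-coloop-in-circuit ¬coloop
  ... | S , circS , f∈S with spanning S circS f∈S
  ... | B , B⊆S , basisB = coloop∉circuit coloop circS (B⊆S (coloop B basisB))

  nonspanning-basis-escapes : ¬ Spanning M D → IsBasis M B → ∃ λ g → g ∈ B × g ∉ D
  nonspanning-basis-escapes {D} {B} ¬spanD basisB with ⊆-or-∉ B D
  ... | inj₁ B⊆D = ⊥-elim (¬spanD (B , B⊆D , basisB))
  ... | inj₂ escape = escape

  circuit-drop₂-indep : IsCircuit M D → a ∈ D → Indep (D - a - b)
  circuit-drop₂-indep (_ , minD) a∈D = indep-⊆ x∈p-y⇒x∈p (minD _ a∈D)

  circuit-drop₂-dependent : IsCircuit M D → ¬ Indep (D - a - b +ₛ a +ₛ b)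
  circuit-drop₂-dependent (depD , _) =
    dependent-⊇ (⊆-trans p⊆p-x+x (⊆-trans (+-mono p⊆p-x+x) +-swap)) depD

  circuit-drop₂-+ˡ-indep : IsCircuit M D → a ∈ D → b ∈ D → a ≢ b → Indep (D - a - b +ₛ a)
  circuit-drop₂-+ˡ-indep (_ , minD) a∈D b∈D a≢b =
    indep-⊆ (+-lub (p⊆q⇒p-x⊆q-x x∈p-y⇒x∈p) (x∈p∧x≢y⇒x∈p-y a∈D a≢b)) (minD _ b∈D)

  circuit-drop₂-+ʳ-indep : IsCircuit M D → a ∈ D → b ∈ D → a ≢ b → Indep (D - a - b +ₛ b)
  circuit-drop₂-+ʳ-indep (_ , minD) a∈D b∈D a≢b = indep-⊆ (p-x-y+y⊆p-x b∈D (a≢b ∘ sym)) (minD _ a∈D)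

  InNonspanningCircuit : Fin n → Set
  InNonspanningCircuit e = Σ (Subset n) λ D → IsCircuit M D × e ∈ D × ¬ Spanning M D

  coloop-or-free-or-in-nonspanning-circuit :
    ∀ e → IsColoop M e ⊎ IsFree M e ⊎ InNonspanningCircuit e
  coloop-or-free-or-in-nonspanning-circuit e
    with anySubset? (λ D → isCircuit? D ×-dec (e ∈? D) ×-dec ¬? (spanning? D))
  ... | yes inNonspanning = inj₂ (inj₂ inNonspanning)
  ... | no none with coloop-or-avoided e
  ... | inj₁ coloop = inj₁ coloop
  ... | inj₂ (B , basisB , e∉B) = inj₂ (inj₁ ((λ coloop → e∉B (coloop B basisB)) , spanning))
    where
    spanning : ∀ D → IsCircuit M D → e ∈ D → Spanning M D
    spanning D circD e∈D = decidable-stable (spanning? D) λ ¬spanD → none (D , circD , e∈D , ¬spanD)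

data Parallel : Fin 3 → Fin 3 → Set where
  0∥1 : Parallel zero (suc zero)
  1∥0 : Parallel (suc zero) zero

parallel-of-distinct : ∀ {a b} → a ≢ b → (∃ λ a′ → Parallel a a′) ⊎ (∃ λ b′ → Parallel b b′)
parallel-of-distinct {zero} _ = inj₁ (_ , 0∥1)
parallel-of-distinct {suc zero} _ = inj₁ (_ , 1∥0)
parallel-of-distinct {suc (suc zero)} {zero} _ = inj₂ (_ , 0∥1)
parallel-of-distinct {suc (suc zero)} {suc zero} _ = inj₂ (_ , 1∥0)
parallel-of-distinct {suc (suc zero)} {suc (suc zero)} a≢b = ⊥-elim (a≢b refl)

parallel-≢-coloop : ∀ {a a′} → Parallel a a′ → a ≢ suc (suc zero)
parallel-≢-coloop 0∥1 ()
parallel-≢-coloop 1∥0 ()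

U12⊕U11-singleton : ∀ a → U12⊕U11-Indep ⁅ a ⁆
U12⊕U11-singleton zero (_ , there ())
U12⊕U11-singleton (suc zero) (() , _)
U12⊕U11-singleton (suc (suc zero)) (() , _)

U12⊕U11-parallel-dependent : ∀ {a a′} → Parallel a a′ → ¬ U12⊕U11-Indep (⁅ a ⁆ +ₛ a′)
U12⊕U11-parallel-dependent 0∥1 ind = ind (here , there here)
U12⊕U11-parallel-dependent 1∥0 ind = ind (here , there here)

U12⊕U11-parallel-coloop : ∀ {a a′} → Parallel a a′ → U12⊕U11-Indep (⁅ a ⁆ +ₛ suc (suc zero))
U12⊕U11-parallel-coloop 0∥1 (_ , there ())
U12⊕U11-parallel-coloop 1∥0 (() , _)

triple : ∀ {n} → Fin n → Fin n → Fin n → Fin 3 → Fin n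
triple x y z zero = x
triple x y z (suc zero) = y
triple x y z (suc (suc zero)) = z

module U12⊕U11-Minors {n : ℕ} (M : Matroid n) where
  open Matroid M
  open MatroidFacts M

  private variable
    B C D : Subset n
    a a′ b : Fin 3
    e f g x y z : Fin n

  -- In M / C the elements x, y are parallel and z is a coloop of the restriction to {x, y, z}.
  record MinorTriple (C : Subset n) (x y z : Fin n) : Set where
    field
      indep-C      : Indep C
      z∉C          : z ∉ C
      dependent-xy : ¬ Indep (C +ₛ x +ₛ y)
      indep-xz     : Indep (C +ₛ x +ₛ z)
      indep-yz     : Indep (C +ₛ y +ₛ z)

    x∉C : x ∉ C
    x∉C x∈C =
      dependent-xy (indep-⊆ (+-lub (+-lub (∈-+ˡ ∘ ∈-+ˡ) (∈-+ˡ (∈-+ˡ x∈C))) (∈-+ˡ ∈-+ʳ)) indep-yz)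

    y∉C : y ∉ C
    y∉C y∈C = dependent-xy (indep-⊆ (+-lub ∈-+ˡ (∈-+ˡ (∈-+ˡ y∈C))) indep-xz)

    x≢y : x ≢ y
    x≢y refl = dependent-xy (indep-⊆ (+-lub (λ w∈ → w∈) ∈-+ʳ) (indep-⊆ ∈-+ˡ indep-xz))

    x≢z : x ≢ z
    x≢z refl = dependent-xy (indep-⊆ +-swap indep-yz)

    y≢z : y ≢ z
    y≢z refl = dependent-xy indep-xz

    triple-injective : Injective _≡_ _≡_ (triple x y z)
    triple-injective {zero} {zero} _ = refl
    triple-injective {zero} {suc zero} eq = ⊥-elim (x≢y eq)
    triple-injective {zero} {suc (suc zero)} eq = ⊥-elim (x≢z eq)
    triple-injective {suc zero} {zero} eq = ⊥-elim (x≢y (sym eq))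
    triple-injective {suc zero} {suc zero} _ = refl
    triple-injective {suc zero} {suc (suc zero)} eq = ⊥-elim (y≢z eq)
    triple-injective {suc (suc zero)} {zero} eq = ⊥-elim (x≢z (sym eq))
    triple-injective {suc (suc zero)} {suc zero} eq = ⊥-elim (y≢z (sym eq))
    triple-injective {suc (suc zero)} {suc (suc zero)} _ = refl

    triple∉C : ∀ a → triple x y z a ∉ C
    triple∉C zero = x∉C
    triple∉C (suc zero) = y∉C
    triple∉C (suc (suc zero)) = z∉C

    C-basis : IsBasisOf M C C
    C-basis = (λ w∈ → w∈) , indep-C , λ _ w∈C _ → w∈C

    contraction-indep : ∀ {I u v} → (∀ {a} → a ∈ I → triple x y z a ∈ C +ₛ u +ₛ v) →
                        Indep (C +ₛ u +ₛ v) → IndepContract M C (image (triple x y z) I)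
    contraction-indep image⊆ ind =
      C , C-basis , indep-⊆ (∪-lub (image-⊆ (triple x y z) image⊆) (∈-+ˡ ∘ ∈-+ˡ)) ind

    realises-indep : ∀ {I} → Dec (zero ∈ I) → U12⊕U11-Indep I →
                     IndepContract M C (image (triple x y z) I)
    realises-indep {I} (yes 0∈I) indI = contraction-indep image⊆ indep-xz
      where
      image⊆ : ∀ {a} → a ∈ I → triple x y z a ∈ C +ₛ x +ₛ z
      image⊆ {zero} _ = ∈-+ˡ ∈-+ʳ
      image⊆ {suc zero} 1∈I = ⊥-elim (indI (0∈I , 1∈I))
      image⊆ {suc (suc zero)} _ = ∈-+ʳ
    realises-indep {I} (no 0∉I) _ = contraction-indep image⊆ indep-yz
      where
      image⊆ : ∀ {a} → a ∈ I → triple x y z a ∈ C +ₛ y +ₛ z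
      image⊆ {zero} 0∈I = ⊥-elim (0∉I 0∈I)
      image⊆ {suc zero} _ = ∈-+ˡ ∈-+ʳ
      image⊆ {suc (suc zero)} _ = ∈-+ʳ

    realises-dependent : ∀ {I} → IndepContract M C (image (triple x y z) I) → U12⊕U11-Indep I
    realises-dependent {I} (B , basisB , indIB) (0∈I , 1∈I) = dependent-xy (indep-⊆ C+x+y⊆ indIB)
      where
      C+x+y⊆ : C +ₛ x +ₛ y ⊆ image (triple x y z) I ∪ B
      C+x+y⊆ = +-lub (+-lub (q⊆p∪q _ B ∘ basisOf-indep-⊇ basisB indep-C)
                             (p⊆p∪q B (∈-image⁺ (triple x y z) 0∈I)))
                      (p⊆p∪q B (∈-image⁺ (triple x y z) 1∈I))

    minor : ∀ a b → HasMinorWith M U12⊕U11-Indep (triple x y z a) (triple x y z b)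
    minor a b = C , triple x y z , triple-injective , triple∉C , (a , refl) , (b , refl) ,
      λ I → realises-indep (zero ∈? I) , realises-dependent

  exchange-triple : Indep C → z ∉ C → y ≢ z → ¬ Indep (C +ₛ x +ₛ y) → Indep (C +ₛ x) →
                    Indep (C +ₛ y +ₛ z) → MinorTriple C x y z
  exchange-triple indC z∉C y≢z depxy indx indyz = record
    { indep-C      = indC
    ; z∉C          = z∉C
    ; dependent-xy = depxy
    ; indep-xz     = exchange y≢z indx indyz (dependent-⊇ +-swap depxy)
    ; indep-yz     = indyz
    }

  circuit-triple : IsCircuit M D → x ∈ D → y ∈ D → x ≢ y → z ∉ D →
                   Indep (D - x - y +ₛ y +ₛ z) → MinorTriple (D - x - y) x y z
  circuit-triple circD x∈D y∈D x≢y z∉D =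
    exchange-triple (circuit-drop₂-indep circD x∈D) (z∉D ∘ x∈p-y⇒x∈p ∘ x∈p-y⇒x∈p)
      (λ { refl → z∉D y∈D }) (circuit-drop₂-dependent circD)
      (circuit-drop₂-+ˡ-indep circD x∈D y∈D x≢y)

  minor-from-circuit-through-both : IsCircuit M D → e ∈ D → f ∈ D → e ≢ f → ¬ Spanning M D →
                                    HasMinorWith M U12⊕U11-Indep e f
  minor-from-circuit-through-both {D} {e} {f} circD e∈D f∈D e≢f ¬spanD
    with extend-to-basis (proj₂ circD f f∈D)
  ... | B , D-f⊆B , basisB with nonspanning-basis-escapes ¬spanD basisB
  ... | g , g∈B , g∉D = MinorTriple.minor triple-fe (suc zero) zero
    where
    triple-fe : MinorTriple (D - f - e) f e g
    triple-fe = circuit-triple circD f∈D e∈D (e≢f ∘ sym) g∉D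
      (indep-⊆ (+-lub (⊆-trans (p-x-y+y⊆p-x e∈D e≢f) D-f⊆B) g∈B) (proj₁ basisB))

  minor-from-independent-exchange : IsCircuit M D → e ∈ D → g ∈ D → e ≢ g → f ∉ D →
                                    Indep (D - e +ₛ f) → HasMinorWith M U12⊕U11-Indep e f
  minor-from-independent-exchange circD e∈D g∈D e≢g f∉D indD-e+f =
    MinorTriple.minor (circuit-triple circD e∈D g∈D e≢g f∉D
      (indep-⊆ (+-mono (p-x-y+y⊆p-x g∈D (e≢g ∘ sym))) indD-e+f)) zero (suc (suc zero))

  minor-from-fundamental-circuit : ∀ {D′ h y} → IsCircuit M D → IsCircuit M D′ → e ∈ D → e ≢ f →
    D′ ⊆ D - e +ₛ f → f ∈ D′ → h ∈ D′ → h ≢ f → y ∈ D → y ∉ D′ - f +ₛ e →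
    HasMinorWith M U12⊕U11-Indep e f
  minor-from-fundamental-circuit {D} {e} {f} {D′} {h} {y}
    circD circD′ e∈D e≢f D′⊆D-e+f f∈D′ h∈D′ h≢f y∈D y∉ =
    MinorTriple.minor triple-fhe (suc (suc zero)) zero
    where
    e∉D′ : e ∉ D′
    e∉D′ e∈D′ = [ (λ e∈D-e → x∈p-y⇒x≢y e∈D-e refl) , e≢f ]′ (∈-+⁻ (D′⊆D-e+f e∈D′))
    D′-f+e⊆D-y : D′ - f +ₛ e ⊆ D - y
    D′-f+e⊆D-y w∈ =
      x∈p∧x≢y⇒x∈p-y (+-lub (x∈p-y⇒x∈p ∘ p⊆q+x⇒p-x⊆q D′⊆D-e+f) e∈D w∈) λ { refl → y∉ w∈ }
    triple-fhe : MinorTriple (D′ - f - h) f h e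
    triple-fhe = circuit-triple circD′ f∈D′ h∈D′ (h≢f ∘ sym) e∉D′
      (indep-⊆ (⊆-trans (+-mono (p-x-y+y⊆p-x h∈D′ h≢f)) D′-f+e⊆D-y) (proj₂ circD y y∈D))

  minor-from-covered-circuit : ∀ {D′ g′} → IsCircuit M D → IsCircuit M D′ → e ∈ D → f ∉ D →
    ¬ Spanning M D → g′ ∈ D → g′ ≢ e → ¬ Indep (D - e +ₛ f) → f ∈ D′ → D ⊆ D′ - f +ₛ e →
    HasMinorWith M U12⊕U11-Indep e f
  minor-from-covered-circuit {D} {e} {f} {D′} {g′}
    circD circD′ e∈D f∉D ¬spanD g′∈D g′≢e depD-e+f f∈D′ D⊆D′-f+e with extend-to-basis (proj₂ circD e e∈D)
  ... | B , D-e⊆B , basisB with nonspanning-basis-escapes ¬spanD basisB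
  ... | g , g∈B , g∉D = MinorTriple.minor triple-feg (suc zero) zero
    where
    J : Subset n
    J = D - e - g′
    dependent-ef : ¬ Indep (J +ₛ e +ₛ f)
    dependent-ef indJef = depD-e+f (indep-⊆ (+-mono p⊆p-x+x)
      (exchange (λ { refl → f∉D e∈D }) (circuit-drop₂-+ʳ-indep circD e∈D g′∈D (g′≢e ∘ sym))
                indJef (circuit-drop₂-dependent circD)))
    J⊆D′-g′ : J ⊆ D′ - g′
    J⊆D′-g′ = p⊆q⇒p-x⊆q-x (x∈p-y⇒x∈p ∘ p⊆q+x⇒p-x⊆q D⊆D′-f+e)
    g′∈D′ : g′ ∈ D′
    g′∈D′ = x∈p-y⇒x∈p (p⊆q+x⇒p-x⊆q D⊆D′-f+e (x∈p∧x≢y⇒x∈p-y g′∈D g′≢e))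
    indep-f : Indep (J +ₛ f)
    indep-f =
      indep-⊆ (+-lub J⊆D′-g′ (x∈p∧x≢y⇒x∈p-y f∈D′ λ { refl → f∉D g′∈D })) (proj₂ circD′ g′ g′∈D′)
    indep-eg : Indep (J +ₛ e +ₛ g)
    indep-eg = exchange (λ { refl → g∉D g′∈D }) (circuit-drop₂-+ˡ-indep circD e∈D g′∈D (g′≢e ∘ sym))
      (indep-⊆ (+-lub (⊆-trans (p-x-y+y⊆p-x g′∈D g′≢e) D-e⊆B) g∈B) (proj₁ basisB))
      (dependent-⊇ +-swap (circuit-drop₂-dependent circD))
    triple-feg : MinorTriple J f e g
    triple-feg = exchange-triple (circuit-drop₂-indep circD e∈D) (g∉D ∘ x∈p-y⇒x∈p ∘ x∈p-y⇒x∈p)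
      (λ { refl → g∉D e∈D }) (dependent-⊇ +-swap dependent-ef) indep-f indep-eg

  minor-from-nonspanning-circuit : Loopless M → IsCircuit M D → e ∈ D → ¬ Spanning M D → e ≢ f →
                                   HasMinorWith M U12⊕U11-Indep e f
  minor-from-nonspanning-circuit {D} {e} {f} loopless circD e∈D ¬spanD e≢f with f ∈? D
  ... | yes f∈D = minor-from-circuit-through-both circD e∈D f∈D e≢f ¬spanD
  ... | no f∉D with loopless⇒circuit-has-other loopless circD e | indep? (D - e +ₛ f)
  ... | g′ , g′∈D , g′≢e | yes indD-e+f =
    minor-from-independent-exchange circD e∈D g′∈D (g′≢e ∘ sym) f∉D indD-e+f
  ... | g′ , g′∈D , g′≢e | no depD-e+f with fundamental-circuit (proj₂ circD e e∈D) depD-e+f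
  ... | D′ , D′⊆D-e+f , circD′ , f∈D′
    with loopless⇒circuit-has-other loopless circD′ f | ⊆-or-∉ D (D′ - f +ₛ e)
  ... | h , h∈D′ , h≢f | inj₂ (y , y∈D , y∉) =
    minor-from-fundamental-circuit circD circD′ e∈D e≢f D′⊆D-e+f f∈D′ h∈D′ h≢f y∈D y∉
  ... | _ | inj₁ D⊆D′-f+e =
    minor-from-covered-circuit circD circD′ e∈D f∉D ¬spanD g′∈D g′≢e depD-e+f f∈D′ D⊆D′-f+e

  record Realises (C : Subset n) (φ : Fin 3 → Fin n) : Set where
    constructor realising
    field
      realises : ∀ I → (U12⊕U11-Indep I → IndepContract M C (image φ I))
                     × (IndepContract M C (image φ I) → U12⊕U11-Indep I)

  module _ {C : Subset n} {φ : Fin 3 → Fin n} (R : Realises C φ) where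
    open Realises R

    realised-+-indep : ∀ a → Σ (Subset n) λ B → IsBasisOf M B C × Indep (B +ₛ φ a)
    realised-+-indep a with proj₁ (realises ⁅ a ⁆) (U12⊕U11-singleton a)
    ... | B , basisB , ind =
      B , basisB , indep-⊆ (+-lub (q⊆p∪q _ B) (p⊆p∪q B (∈-image⁺ φ (x∈⁅x⁆ a)))) ind

    realised-+₂-indep : U12⊕U11-Indep (⁅ a ⁆ +ₛ b) →
                        Σ (Subset n) λ B → IsBasisOf M B C × Indep (B +ₛ φ a +ₛ φ b)
    realised-+₂-indep {a} {b} indab with proj₁ (realises (⁅ a ⁆ +ₛ b)) indab
    ... | B , basisB , ind = B , basisB , indep-⊆ B+φa+φb⊆ ind
      where
      B+φa+φb⊆ : B +ₛ φ a +ₛ φ b ⊆ image φ (⁅ a ⁆ +ₛ b) ∪ B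
      B+φa+φb⊆ = +-lub (+-lub (q⊆p∪q _ B) (p⊆p∪q B (∈-image⁺ φ {⁅ a ⁆ +ₛ b} (∈-+ˡ (x∈⁅x⁆ a)))))
                       (p⊆p∪q B (∈-image⁺ φ {⁅ a ⁆ +ₛ b} ∈-+ʳ))

    realised-+₂-dependent : ¬ U12⊕U11-Indep (⁅ a ⁆ +ₛ b) → IsBasisOf M B C →
                            ¬ Indep (B +ₛ φ a +ₛ φ b)
    realised-+₂-dependent {a} {b} {B} depab basisB ind =
      depab (proj₂ (realises _) (B , basisB , indep-⊆ (∪-lub (image-⊆ φ image⊆) (∈-+ˡ ∘ ∈-+ˡ)) ind))
      where
      image⊆ : ∀ {k} → k ∈ ⁅ a ⁆ +ₛ b → φ k ∈ B +ₛ φ a +ₛ φ b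
      image⊆ k∈ with ∈-+⁻ k∈
      ... | inj₁ k∈⁅a⁆ with x∈⁅y⁆⇒x≡y a k∈⁅a⁆
      ... | refl = ∈-+ˡ ∈-+ʳ
      image⊆ k∈ | inj₂ refl = ∈-+ʳ

    realised-parallel-not-coloop : Parallel a a′ → ¬ IsColoop M (φ a)
    realised-parallel-not-coloop {a} {a′} par coloop with realised-+-indep a′
    ... | B₀ , basisB₀ , indB₀a′ with extend-to-basis indB₀a′
    ... | B , B₀+a′⊆B , basisB = realised-+₂-dependent (U12⊕U11-parallel-dependent par) basisB₀
      (indep-⊆ (+-lub (+-lub (B₀+a′⊆B ∘ ∈-+ˡ) (coloop B basisB)) (B₀+a′⊆B ∈-+ʳ)) (proj₁ basisB))

    realised-parallel-not-free : Injective _≡_ _≡_ φ → (∀ a → φ a ∉ C) → Parallel a a′ →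
                                 ¬ IsFree M (φ a)
    realised-parallel-not-free {a} {a′} φ-injective φ∉C par (_ , spanning)
      with realised-+₂-indep (U12⊕U11-parallel-coloop par) | realised-+-indep a′
    ... | B₀ , basisB₀ , indB₀+a+c | B₁ , basisB₁ , indB₁+a′
      with fundamental-circuit (basisOf-+-indep basisB₀ basisB₁ (φ∉C a′) indB₁+a′)
             (dependent-⊇ +-swap (realised-+₂-dependent (U12⊕U11-parallel-dependent par) basisB₀))
    ... | S , S⊆ , circS , φa∈S = <-irrefl refl (begin-strict
      ∣ B₀ +ₛ φ a +ₛ φ c ∣   <⟨ spanning-circuit-exceeds-indep circS spanS indB₀+a+c ⟩
      ∣ S ∣                  ≤⟨ p⊆q⇒∣p∣≤∣q∣ S⊆ ⟩
      ∣ B₀ +ₛ φ a′ +ₛ φ a ∣  ≤⟨ ∣p+x+y∣≤2+∣p∣ B₀ (φ a′) (φ a) ⟩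
      2 + ∣ B₀ ∣             ≤⟨ 2+∣p∣≤∣p+x+y∣ (φ∉C a ∘ proj₁ basisB₀) φc∉B₀+φa ⟩
      ∣ B₀ +ₛ φ a +ₛ φ c ∣   ∎)
      where
      open ≤-Reasoning
      spanS : Spanning M S
      spanS = spanning S circS φa∈S
      c : Fin 3
      c = suc (suc zero)
      φc∉B₀+φa : φ c ∉ B₀ +ₛ φ a
      φc∉B₀+φa = [ φ∉C c ∘ proj₁ basisB₀ , parallel-≢-coloop par ∘ sym ∘ φ-injective ]′ ∘ ∈-+⁻

  ExcludedByParallel : (Fin n → Set) → Set
  ExcludedByParallel P = ∀ {C φ} → Realises C φ → ∀ {a a′} → Injective _≡_ _≡_ φ →
                         (∀ a → φ a ∉ C) → Parallel a a′ → ¬ P (φ a)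

  at-most-one-by-minors : ∀ {P} → ExcludedByParallel P →
                          (∀ e f → e ≢ f → HasMinorWith M U12⊕U11-Indep e f) → AtMostOne M P
  at-most-one-by-minors {P} excluded minors e f Pe Pf =
    decidable-stable (e ≟ f) λ e≢f → by-minor e≢f (minors e f e≢f) Pe Pf
    where
    by-minor : e ≢ f → HasMinorWith M U12⊕U11-Indep e f → P e → P f → ⊥
    by-minor e≢f (C , φ , φ-injective , φ∉C , (a , refl) , (b , refl) , realises) Pe Pf
      with parallel-of-distinct (e≢f ∘ cong φ)
    ... | inj₁ (_ , par) = excluded (realising {C} {φ} realises) φ-injective φ∉C par Pe
    ... | inj₂ (_ , par) = excluded (realising {C} {φ} realises) φ-injective φ∉C par Pf

  minor-loopless : HasMinorWith M U12⊕U11-Indep e f → ¬ IsLoop M e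
  minor-loopless (C , φ , _ , _ , (a , refl) , _ , realises) loop
    with realised-+-indep (realising {C} {φ} realises) a
  ... | B , _ , indB+a = loop (indep-⊆ (q⊆p∪q B ⁅ φ a ⁆) indB+a)

  minor-sym : HasMinorWith M U12⊕U11-Indep f e → HasMinorWith M U12⊕U11-Indep e f
  minor-sym (C , φ , φ-injective , φ∉C , f-in , e-in , realises) =
    C , φ , φ-injective , φ∉C , e-in , f-in , realises

  minor-from-constraints : Loopless M → AtMostOne M (IsColoop M) → AtMostOne M (IsFree M) →
                           e ≢ f → HasMinorWith M U12⊕U11-Indep e f
  minor-from-constraints {e} {f} loopless one-coloop one-free e≢f
    with coloop-or-free-or-in-nonspanning-circuit e | coloop-or-free-or-in-nonspanning-circuit f
  ... | inj₂ (inj₂ (D , circD , e∈D , ¬spanD)) | _ =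
    minor-from-nonspanning-circuit loopless circD e∈D ¬spanD e≢f
  ... | _ | inj₂ (inj₂ (D , circD , f∈D , ¬spanD)) =
    minor-sym (minor-from-nonspanning-circuit loopless circD f∈D ¬spanD (e≢f ∘ sym))
  ... | inj₁ coloop-e | inj₁ coloop-f = ⊥-elim (e≢f (one-coloop e f coloop-e coloop-f))
  ... | inj₁ coloop-e | inj₂ (inj₁ free-f) = ⊥-elim (coloop-free-exclusive coloop-e free-f)
  ... | inj₂ (inj₁ free-e) | inj₁ coloop-f = ⊥-elim (coloop-free-exclusive coloop-f free-e)
  ... | inj₂ (inj₁ free-e) | inj₂ (inj₁ free-f) = ⊥-elim (e≢f (one-free e f free-e free-f))

other-element : ∀ {n} → n ≥ 2 → (e : Fin n) → ∃ λ f → e ≢ f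
other-element (s≤s (s≤s _)) zero = suc zero , λ ()
other-element (s≤s (s≤s _)) (suc e) = zero , λ ()

theorem5p2 : ∀ {n} (M : Matroid n) → n ≥ 2 →
    Connected-for U12⊕U11-Indep M ⇔
      (Loopless M × AtMostOne M (IsColoop M) × AtMostOne M (IsFree M))
theorem5p2 M n≥2 = mk⇔
  (λ (_ , minors) →
      (λ e → minor-loopless (minors e _ (proj₂ (other-element n≥2 e))))
    , at-most-one-by-minors (λ R _ _ → realised-parallel-not-coloop R) minors
    , at-most-one-by-minors realised-parallel-not-free minors)
  (λ (loopless , one-coloop , one-free) →
      n≥2 , λ e f → minor-from-constraints loopless one-coloop one-free)
  where open U12⊕U11-Minors M
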